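{- Let $H$ be a graph with maximum degree $\Delta$ and diameter $k\geq 2$. Then there is a $3$-colourable graph with $3|V(H)|$ vertices, maximum degree $2\Delta+2$ and diameter at most $k$. Moreover, if $k\geq 4$ then there is a $3$-colourable triangle-free graph with $5|V(H)|$ vertices, maximum degree $2\Delta+2$, and diameter at most $k$. -}

module Defs where

open import Data.Nat using (ℕ; zero; suc; _+_; _≤_; _<_)
open import Data.Fin using (Fin)
open import Data.Bool using (Bool; true; false; T)
open import Data.List using (List; length; filter)
open import Data.List renaming (allFin to allFinL) using ()
open import Data.Empty using (⊥)
open import Data.Product using (Σ; ∃; ∃-syntax; _×_; _,_)
open import Relation.Nullary using (¬_)
open import Relation.Binary.PropositionalEquality using (_≡_; _≢_)
open import Data.Bool using (T?)

record Graph : Set where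
  field
    n     : ℕ
    adj   : Fin n → Fin n → Bool
    sym   : ∀ u v → adj u v ≡ adj v u
    irrefl : ∀ v → adj v v ≡ false

open Graph public

∣V∣ : Graph → ℕ
∣V∣ G = n G

Adj : (G : Graph) → Fin (n G) → Fin (n G) → Set
Adj G u v = T (adj G u v)

degree : (G : Graph) → Fin (n G) → ℕ
degree G v = length (filter (λ u → T? (adj G v u)) (allFinL (n G)))

HasMaxDegree : Graph → ℕ → Set
HasMaxDegree G Δ = (∀ v → degree G v ≤ Δ) × (∃[ v ] degree G v ≡ Δ)

data Walk (G : Graph) : Fin (n G) → Fin (n G) → ℕ → Set where
  [] : ∀ {u} → Walk G u u 0
  _∷_ : ∀ {u w v ℓ} → Adj G u w → Walk G w v ℓ → Walk G u v (suc ℓ)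

DistLe : (G : Graph) → Fin (n G) → Fin (n G) → ℕ → Set
DistLe G u v ℓ = ∃[ m ] (m ≤ ℓ × Walk G u v m)

DiamLe : Graph → ℕ → Set
DiamLe G k = ∀ u v → DistLe G u v k

HasDiameter : Graph → ℕ → Set
HasDiameter G k = DiamLe G k × (∃[ u ] ∃[ v ] ¬ (∃[ m ] (m < k × Walk G u v m)))

ThreeColourable : Graph → Set
ThreeColourable G = Σ (Fin (n G) → Fin 3) λ c → ∀ u v → Adj G u v → c u ≢ c v

TriangleFree : Graph → Set
TriangleFree G = ∀ u v w → Adj G u v → Adj G v w → Adj G u w → ⊥

-- Take the tensor product of H, with a loop added at every vertex, and a small
-- graph K that is 2-regular and in which any two vertices are joined by walks of
-- every length ℓ ≥ b: the triangle K₃ (b = 2) or the pentagon C₅ (b = 4).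
-- A vertex (i , u) has 2 (deg u + 1) neighbours, projecting onto K is a
-- homomorphism (so colourings and triangle-freeness of K lift), and a walk of
-- length m ≤ k in H, padded by pauses to length k, runs alongside a walk of
-- length k in K, giving diameter ≤ k as soon as b ≤ k.
module Submission where

open import Defs hiding (sym)
open import Data.Nat using (ℕ; zero; suc; _+_; _*_; _≤_; _∸_; s≤s; _%_)
open import Data.Nat.Properties
  using (+-*-semiring; +-assoc; +-suc; +-comm; *-suc; *-monoʳ-≤; ≤-refl; m∸n+n≡m)
  renaming (_≟_ to _≟ℕ_)
open import Data.Fin using (Fin; zero; suc; toℕ; _↑ˡ_; _↑ʳ_; combine; remQuot)
open import Data.Fin.Properties using (_≟_; any?; all?; remQuot-combine; combine-remQuot)
open import Data.Bool using (Bool; true; false; T; not; _∧_; _∨_; T?)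
open import Data.Bool.Properties using (T-∧; T-∨; T-≡; ∨-comm) renaming (_≟_ to _≟ᵇ_)
open import Data.List using (length; filter; tabulate)
open import Data.Product using (Σ; _×_; _,_; proj₁)
open import Data.Sum using (inj₁; inj₂)
open import Data.Vec.Functional using (Vector)
open import Function using (_∘_; id; Equivalence; mk⇔)
open import Relation.Nullary using (Dec; does; no; ¬?; _×-dec_; _→-dec_)
open import Relation.Nullary.Decidable using (map′; from-yes; dec-true; does-⇔)
open import Relation.Binary.PropositionalEquality
  using (_≡_; _≢_; refl; sym; trans; cong; cong₂; subst; module ≡-Reasoning)
open import Algebra.Properties.Semiring.Sum +-*-semiring
  using (sum; sum-cong-≗; *-distribˡ-sum; *-distribʳ-sum)

open Equivalence using (to; from)

⟦_⟧ : Bool → ℕ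
⟦ true ⟧  = 1
⟦ false ⟧ = 0

⟦∧⟧ : ∀ a b → ⟦ a ∧ b ⟧ ≡ ⟦ a ⟧ * ⟦ b ⟧
⟦∧⟧ true  true  = refl
⟦∧⟧ true  false = refl
⟦∧⟧ false _     = refl

count : ∀ {m} → (Fin m → Bool) → ℕ
count p = sum (⟦_⟧ ∘ p)

sum-↑ : ∀ m {k} (f : Vector ℕ (m + k)) → sum f ≡ sum (f ∘ (_↑ˡ k)) + sum (f ∘ (m ↑ʳ_))
sum-↑ zero    f = refl
sum-↑ (suc m) f = trans (cong (f zero +_) (sum-↑ m (f ∘ suc))) (sym (+-assoc (f zero) _ _))

sum-combine : ∀ m {k} (f : Vector ℕ (m * k)) →
              sum f ≡ sum (λ i → sum (λ j → f (combine {m} i j)))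
sum-combine zero        f = refl
sum-combine (suc m) {k} f =
  trans (sum-↑ k f) (cong (sum (λ j → f (j ↑ˡ (m * k))) +_) (sum-combine m (f ∘ (k ↑ʳ_))))

count-insert : ∀ {m} (v : Fin m) (p : Fin m → Bool) → p v ≡ false →
               count (λ u → does (v ≟ u) ∨ p u) ≡ suc (count p)
count-insert zero    p pv≡false rewrite pv≡false = refl
count-insert (suc v) p pv≡false =
  trans (cong (⟦ p zero ⟧ +_) (count-insert v (p ∘ suc) pv≡false)) (+-suc _ _)

length-filter-tabulate : ∀ {A : Set} {m} (p : A → Bool) (g : Fin m → A) →
                         length (filter (T? ∘ p) (tabulate g)) ≡ count (p ∘ g)
length-filter-tabulate {m = zero}  p g = refl
length-filter-tabulate {m = suc m} p g with p (g zero)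
... | true  = cong suc (length-filter-tabulate p (g ∘ suc))
... | false = length-filter-tabulate p (g ∘ suc)

all-combine : ∀ {m k} {P : Fin (m * k) → Set} → (∀ i j → P (combine {m} i j)) → ∀ x → P x
all-combine {m} {k} {P} P-combine x = subst P (combine-remQuot {m} k x) (P-combine _ _)

≟-sym : ∀ {m} (u v : Fin m) → does (u ≟ v) ≡ does (v ≟ u)
≟-sym u v = does-⇔ (mk⇔ sym sym) (u ≟ v) (v ≟ u)

T-≟-refl : ∀ {m} (u : Fin m) → T (does (u ≟ u))
T-≟-refl u = from T-≡ (dec-true (u ≟ u) refl)

degree≡count : (G : Graph) (v : Fin (n G)) → degree G v ≡ count (adj G v)
degree≡count G v = length-filter-tabulate (adj G v) id

closedAdj : (H : Graph) → Fin (n H) → Fin (n H) → Bool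
closedAdj H u v = does (u ≟ v) ∨ adj H u v

closedAdj-sym : (H : Graph) (u v : Fin (n H)) → closedAdj H u v ≡ closedAdj H v u
closedAdj-sym H u v = cong₂ _∨_ (≟-sym u v) (Graph.sym H u v)

count-closedAdj : (H : Graph) (v : Fin (n H)) → count (closedAdj H v) ≡ suc (degree H v)
count-closedAdj H v =
  trans (count-insert v (adj H v) (irrefl H v)) (cong suc (sym (degree≡count H v)))

⊗-adj : (K H : Graph) → Fin (n K) × Fin (n H) → Fin (n K) × Fin (n H) → Bool
⊗-adj K H (i , u) (j , v) = adj K i j ∧ closedAdj H u v

-- The vertex (i , u) of K ⊗ H is encoded as combine i u.
infixl 7 _⊗_
_⊗_ : Graph → Graph → Graph
K ⊗ H = record
  { n      = n K * n H
  ; adj    = λ x y → ⊗-adj K H (remQuot (n H) x) (remQuot (n H) y)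
  ; sym    = λ x y → cong₂ _∧_ (Graph.sym K _ _) (closedAdj-sym H _ _)
  ; irrefl = λ x → cong (_∧ _) (irrefl K _)
  }

⊗-adj-combine : (K H : Graph) (i j : Fin (n K)) (u v : Fin (n H)) →
                adj (K ⊗ H) (combine {n K} i u) (combine {n K} j v) ≡ adj K i j ∧ closedAdj H u v
⊗-adj-combine K H i j u v =
  cong₂ (⊗-adj K H) (remQuot-combine {n K} i u) (remQuot-combine {n K} j v)

⊗-degree : (K H : Graph) (i : Fin (n K)) (v : Fin (n H)) →
           degree (K ⊗ H) (combine {n K} i v) ≡ degree K i * suc (degree H v)
⊗-degree K H i v = begin
  degree (K ⊗ H) (combine {n K} i v)
    ≡⟨ degree≡count (K ⊗ H) (combine {n K} i v) ⟩
  count (adj (K ⊗ H) (combine {n K} i v))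
    ≡⟨ sum-combine (n K) _ ⟩
  sum (λ j → sum (λ u → ⟦ adj (K ⊗ H) (combine {n K} i v) (combine {n K} j u) ⟧))
    ≡⟨ sum-cong-≗ {n K} (λ j → sum-cong-≗ {n H} (λ u →
         trans (cong ⟦_⟧ (⊗-adj-combine K H i j v u)) (⟦∧⟧ (adj K i j) (closedAdj H v u)))) ⟩
  sum (λ j → sum (λ u → ⟦ adj K i j ⟧ * ⟦ closedAdj H v u ⟧))
    ≡⟨ sum-cong-≗ {n K} (λ j → sym (*-distribˡ-sum ⟦ adj K i j ⟧ (⟦_⟧ ∘ closedAdj H v))) ⟩
  sum (λ j → ⟦ adj K i j ⟧ * count (closedAdj H v))
    ≡⟨ sym (*-distribʳ-sum (count (closedAdj H v)) (⟦_⟧ ∘ adj K i)) ⟩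
  count (adj K i) * count (closedAdj H v)
    ≡⟨ cong₂ _*_ (sym (degree≡count K i)) (count-closedAdj H v) ⟩
  degree K i * suc (degree H v)
    ∎
  where open ≡-Reasoning

Regular : Graph → ℕ → Set
Regular K r = ∀ i → degree K i ≡ r

⊗-maxDegree : ∀ K H {r Δ} → Regular K r → Fin (n K) → HasMaxDegree H Δ →
              HasMaxDegree (K ⊗ H) (r * suc Δ)
⊗-maxDegree K H {r} {Δ} regular i₀ (bounded , v₀ , attained) =
  all-combine (λ i v → subst (_≤ r * suc Δ) (sym (degree-combine i v))
                             (*-monoʳ-≤ r (s≤s (bounded v)))) ,
  combine {n K} i₀ v₀ , trans (degree-combine i₀ v₀) (cong (λ d → r * suc d) attained)
  where
  degree-combine : ∀ i v → degree (K ⊗ H) (combine {n K} i v) ≡ r * suc (degree H v)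
  degree-combine i v = trans (⊗-degree K H i v) (cong (_* suc (degree H v)) (regular i))

data LazyWalk (H : Graph) : Fin (n H) → Fin (n H) → ℕ → Set where
  []  : ∀ {u} → LazyWalk H u u 0
  _∷_ : ∀ {u w v ℓ} → T (closedAdj H u w) → LazyWalk H w v ℓ → LazyWalk H u v (suc ℓ)

pause : ∀ {H u} ℓ → LazyWalk H u u ℓ
pause zero            = []
pause {u = u} (suc ℓ) = from T-∨ (inj₁ (T-≟-refl u)) ∷ pause ℓ

lazify : ∀ {H u v m k} → Walk H u v m → m ≤ k → LazyWalk H u v k
lazify []      _          = pause _
lazify (a ∷ w) (s≤s m≤k) = from T-∨ (inj₂ a) ∷ lazify w m≤k

⊗-walk : ∀ {K H i j u v ℓ} → Walk K i j ℓ → LazyWalk H u v ℓ →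
         Walk (K ⊗ H) (combine {n K} i u) (combine {n K} j v) ℓ
⊗-walk             []      []      = []
⊗-walk {K} {H} {i} {u = u} (a ∷ p) (b ∷ q) =
  subst T (sym (⊗-adj-combine K H i _ u _)) (from T-∧ (a , b)) ∷ ⊗-walk p q

Joined : Graph → ℕ → Set
Joined K ℓ = ∀ i j → Walk K i j ℓ

JoinedByAllLengths : Graph → ℕ → Set
JoinedByAllLengths K b = ∀ ℓ → b ≤ ℓ → Joined K ℓ

joined⇒joinedByAllLengths : ∀ K {b} → Joined K (suc b) → JoinedByAllLengths K (suc b)
joined⇒joinedByAllLengths K {b} walks ℓ b<ℓ i j =
  subst (Walk K i j) (m∸n+n≡m b<ℓ) (extend (ℓ ∸ suc b) i j)
  where
  -- The first step of a closed walk of length suc b at i supplies a neighbour of i.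
  extend : ∀ d i j → Walk K i j (d + suc b)
  extend zero    i j = walks i j
  extend (suc d) i j with walks i i
  ... | a ∷ _ = a ∷ extend d _ j

⊗-diameter : ∀ K H {b k} → JoinedByAllLengths K b → b ≤ k → DiamLe H k → DiamLe (K ⊗ H) k
⊗-diameter K H {b} {k} joined b≤k diamH =
  all-combine {P = λ x → ∀ y → DistLe (K ⊗ H) x y k} λ i u →
  all-combine {P = λ y → DistLe (K ⊗ H) (combine {n K} i u) y k} λ j v →
  let (m , m≤k , w) = diamH u v in
  k , ≤-refl , ⊗-walk (joined k b≤k i j) (lazify w m≤k)

Homomorphism : Graph → Graph → Set
Homomorphism G K = Σ (Fin (n G) → Fin (n K)) λ f → ∀ u v → Adj G u v → Adj K (f u) (f v)

⊗-projection : (K H : Graph) → Homomorphism (K ⊗ H) K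
⊗-projection K H = (λ x → proj₁ (remQuot (n H) x)) , λ x y a → proj₁ (to T-∧ a)

colourable-hom : ∀ G K → Homomorphism G K → ThreeColourable K → ThreeColourable G
colourable-hom G K (f , hom) (c , proper) = c ∘ f , λ u v a → proper (f u) (f v) (hom u v a)

triangleFree-hom : ∀ G K → Homomorphism G K → TriangleFree K → TriangleFree G
triangleFree-hom G K (f , hom) triangleFree u v w a b c =
  triangleFree (f u) (f v) (f w) (hom u v a) (hom v w b) (hom u w c)

walk? : (G : Graph) (ℓ : ℕ) (u v : Fin (n G)) → Dec (Walk G u v ℓ)
walk? G zero    u v = map′ (λ { refl → [] }) (λ { [] → refl }) (u ≟ v)
walk? G (suc ℓ) u v =
  map′ (λ (w , a , p) → a ∷ p) (λ { (a ∷ p) → _ , a , p })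
       (any? λ w → T? (adj G u w) ×-dec walk? G ℓ w v)

joined? : (G : Graph) (ℓ : ℕ) → Dec (Joined G ℓ)
joined? G ℓ = all? λ u → all? λ v → walk? G ℓ u v

regular? : (G : Graph) (r : ℕ) → Dec (Regular G r)
regular? G r = all? λ v → degree G v ≟ℕ r

properColouring? : (G : Graph) (c : Fin (n G) → Fin 3) → Dec (∀ u v → Adj G u v → c u ≢ c v)
properColouring? G c = all? λ u → all? λ v → T? (adj G u v) →-dec ¬? (c u ≟ c v)

triangleFree? : (G : Graph) → Dec (TriangleFree G)
triangleFree? G = all? λ u → all? λ v → all? λ w →
  T? (adj G u v) →-dec (T? (adj G v w) →-dec (T? (adj G u w) →-dec no λ ()))

complete : ℕ → Graph
complete m = record
  { n      = m
  ; adj    = λ i j → not (does (i ≟ j))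
  ; sym    = λ i j → cong not (≟-sym i j)
  ; irrefl = λ i → cong not (dec-true (i ≟ i) refl)
  }

K₃ : Graph
K₃ = complete 3

C₅ : Graph
C₅ = record
  { n      = 5
  ; adj    = C₅-adj
  ; sym    = λ i j → ∨-comm (does (suc (toℕ i) % 5 ≟ℕ toℕ j)) (does (suc (toℕ j) % 5 ≟ℕ toℕ i))
  ; irrefl = from-yes (all? λ i → C₅-adj i i ≟ᵇ false)
  }
  where
  C₅-adj : Fin 5 → Fin 5 → Bool
  C₅-adj i j = does (suc (toℕ i) % 5 ≟ℕ toℕ j) ∨ does (suc (toℕ j) % 5 ≟ℕ toℕ i)

C₅-colouring : Fin 5 → Fin 3
C₅-colouring zero                         = zero
C₅-colouring (suc zero)                   = suc zero
C₅-colouring (suc (suc zero))             = zero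
C₅-colouring (suc (suc (suc zero)))       = suc zero
C₅-colouring (suc (suc (suc (suc zero)))) = suc (suc zero)

K₃-regular : Regular K₃ 2
K₃-regular = from-yes (regular? K₃ 2)

C₅-regular : Regular C₅ 2
C₅-regular = from-yes (regular? C₅ 2)

K₃-joined : JoinedByAllLengths K₃ 2
K₃-joined = joined⇒joinedByAllLengths K₃ (from-yes (joined? K₃ 2))

C₅-joined : JoinedByAllLengths C₅ 4
C₅-joined = joined⇒joinedByAllLengths C₅ (from-yes (joined? C₅ 4))

K₃-colourable : ThreeColourable K₃
K₃-colourable = id , from-yes (properColouring? K₃ id)

C₅-colourable : ThreeColourable C₅
C₅-colourable = C₅-colouring , from-yes (properColouring? C₅ C₅-colouring)

C₅-triangleFree : TriangleFree C₅
C₅-triangleFree = from-yes (triangleFree? C₅)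

mainTheorem17 : (H : Graph) (Δ k : ℕ) → HasMaxDegree H Δ → HasDiameter H k → 2 ≤ k →
    (Σ Graph λ G → ThreeColourable G × ∣V∣ G ≡ 3 * ∣V∣ H × HasMaxDegree G (2 * Δ + 2) × DiamLe G k)
    × (4 ≤ k → Σ Graph λ G → ThreeColourable G × TriangleFree G × ∣V∣ G ≡ 5 * ∣V∣ H × HasMaxDegree G (2 * Δ + 2) × DiamLe G k)
mainTheorem17 H Δ k maxDegree (diameter , _) 2≤k =
  ( K₃ ⊗ H
  , colourable-hom (K₃ ⊗ H) K₃ (⊗-projection K₃ H) K₃-colourable
  , refl
  , maxDegree-2-regular K₃ K₃-regular zero
  , ⊗-diameter K₃ H K₃-joined 2≤k diameter
  ) ,
  λ 4≤k →
  ( C₅ ⊗ H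
  , colourable-hom (C₅ ⊗ H) C₅ (⊗-projection C₅ H) C₅-colourable
  , triangleFree-hom (C₅ ⊗ H) C₅ (⊗-projection C₅ H) C₅-triangleFree
  , refl
  , maxDegree-2-regular C₅ C₅-regular zero
  , ⊗-diameter C₅ H C₅-joined 4≤k diameter
  )
  where
  maxDegree-2-regular : ∀ K → Regular K 2 → Fin (n K) → HasMaxDegree (K ⊗ H) (2 * Δ + 2)
  maxDegree-2-regular K regular i₀ =
    subst (HasMaxDegree (K ⊗ H)) (trans (*-suc 2 Δ) (+-comm 2 (2 * Δ)))
          (⊗-maxDegree K H regular i₀ maxDegree)
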